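{- $\beta^k_{R/}$ is equivalently defined by \begin{eqnarray*} \beta^k_{R/}(\vec{E}[G]_k)&=&\bigcup\{\Gamma u\in\mathcal{G}(Z_{i_k})\mid\alpha_R(\vec{E}[\Gamma u]_k)\subseteq G\}\\ \beta^k_{R/}(\vec{E}[G]_k)&=&\{ u\in Z_{i_k}\mid\alpha_R(\vec{E}[\Gamma u]_k)\subseteq G\} \end{eqnarray*}
   Context: Let $(X,I,Y)$ be a polarity: nonempty sets $Z_1=X$, $Z_\partial=Y$ and a relation $I\subseteq X\times Y$, inducing the Galois connection $U^{\perp}=\{y\in Y\mid \forall x\in U\; xIy\}$, ${}^{\perp}V=\{x\in X\mid \forall y\in V\; xIy\}$. Galois sets are the stable sets $A={}^{\perp}(A^{\perp})\subseteq X$ and co-stable sets $B=({}^{\perp}B)^{\perp}\subseteq Y$, forming $\mathcal{G}(Z_1)=\mathcal G(X)$, $\mathcal{G}(Z_\partial)=\mathcal G(Y)$. Preorders: for $x,z\in X$, $x\preceq z$ iff $\{x\}^{\perp}\subseteq\{z\}^{\perp}$; for $y,v\in Y$, $y\preceq v$ iff ${}^{\perp}\{y\}\subseteq{}^{\perp}\{v\}$; $\Gamma u=\{w\mid u\preceq w\}$ (which is a Galois set). Let $R\subseteq Z_{i_{n+1}}\times\prod_{j=1}^n Z_{i_j}$ be a relation with image operator $\alpha_R(\vec{W})=\bigcup_{\vec{w}\in\vec{W}}R\vec{w}$ (monotone in each argument). $\vec{E}[F]_k$ is the tuple $\vec E$ with $k$-th component replaced by $F$. For Galois sets $E_j$ and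 $G$, $\beta^k_{R/}(\vec{E}[G]_k)=\bigcup\{F\in\mathcal{G}(Z_{i_k})\mid\alpha_R(\vec{E}[F]_k)\subseteq G\}$. -}

module Defs where

open import Level using (0ℓ)
open import Data.Nat using (ℕ)
open import Data.Fin using (Fin; _≟_)
open import Data.Product using (Σ; ∃; _×_; _,_)
open import Relation.Unary using (Pred; _⊆_; _≐_; _∈_)
open import Relation.Nullary using (yes; no)
open import Relation.Binary.PropositionalEquality using (refl)

data Sort : Set where
  one ∂ : Sort

module Polarity (X Y : Set) (I : X → Y → Set) where

  Z : Sort → Set
  Z one = X
  Z ∂   = Y

  _⊥ : Pred X 0ℓ → Pred Y 0ℓ
  (U ⊥) y = ∀ x → x ∈ U → I x y

  ⊥_ : Pred Y 0ℓ → Pred X 0ℓ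
  (⊥ V) x = ∀ y → y ∈ V → I x y

  cl : (s : Sort) → Pred (Z s) 0ℓ → Pred (Z s) 0ℓ
  cl one A = ⊥ (A ⊥)
  cl ∂   B = (⊥ B) ⊥

  IsGalois : (s : Sort) → Pred (Z s) 0ℓ → Set
  IsGalois s A = A ≐ cl s A

  _⪯_ : {s : Sort} → Z s → Z s → Set
  _⪯_ {one} x z = ∀ y → I x y → I z y
  _⪯_ {∂}   y v = ∀ x → I x y → I x v

  Γ : {s : Sort} → Z s → Pred (Z s) 0ℓ
  Γ u w = u ⪯ w

  -- Relations R ⊆ Z_{i_{n+1}} × ∏_j Z_{i_j} with sort signature (i, t).
  Args : {n : ℕ} → (Fin n → Sort) → Set
  Args i = (j : Fin _) → Z (i j)

  Sets : {n : ℕ} → (Fin n → Sort) → Set₁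
  Sets i = (j : Fin _) → Pred (Z (i j)) 0ℓ

  α : {n : ℕ} {i : Fin n → Sort} {t : Sort} →
      (Z t → Args i → Set) → Sets i → Pred (Z t) 0ℓ
  α {i = i} R W z = Σ (Args i) λ w → ((j : Fin _) → w j ∈ W j) × R z w

  upd : {n : ℕ} {i : Fin n → Sort} → Sets i → (k : Fin n) →
        Pred (Z (i k)) 0ℓ → Sets i
  upd E k F j with j ≟ k
  ... | yes refl = F
  ... | no _     = E j

  β : {n : ℕ} {i : Fin n → Sort} {t : Sort} →
      (Z t → Args i → Set) → Sets i → (k : Fin n) →
      Pred (Z t) 0ℓ → Pred (Z (i k)) _
  β {i = i} R E k G u =
    Σ (Pred (Z (i k)) 0ℓ) λ F →
      IsGalois (i k) F × (α R (upd E k F) ⊆ G) × (u ∈ F)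

{-# OPTIONS --safe #-}
-- A Galois set F is upward closed for ⪯, so u ∈ F forces Γ u ⊆ F, and by
-- monotonicity of α_R every u ∈ β^k_{R/}(E⃗[G]_k) already satisfies
-- α_R(E⃗[Γ u]_k) ⊆ G. Conversely Γ u is itself a Galois set containing u,
-- so it witnesses u ∈ β^k_{R/}(E⃗[G]_k) whenever α_R(E⃗[Γ u]_k) ⊆ G.
module Submission where

open import Defs
open import Level using (0ℓ)
open import Data.Nat using (ℕ)
open import Data.Fin using (Fin; _≟_)
open import Data.Product using (Σ; _×_; _,_; proj₁)
open import Function using (_∘_; id)
open import Relation.Unary using (Pred; _⊆_; _≐_; _∈_)
open import Relation.Nullary using (yes; no)
open import Relation.Binary.PropositionalEquality using (refl)

module PolarityProperties (X Y : Set) (I : X → Y → Set) where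
  open Polarity X Y I

  ⪯-refl : {s : Sort} (u : Z s) → u ⪯ u
  ⪯-refl {one} u y uIy = uIy
  ⪯-refl {∂}   u x xIu = xIu

  Γ-isGalois : {s : Sort} (u : Z s) → IsGalois s (Γ u)
  Γ-isGalois {one} u = (λ u⪯w y yU → yU _ u⪯w)
                     , (λ w∈cl y uIy → w∈cl y (λ x u⪯x → u⪯x y uIy))
  Γ-isGalois {∂}   u = (λ u⪯w x xU → xU _ u⪯w)
                     , (λ w∈cl x xIu → w∈cl x (λ y u⪯y → u⪯y x xIu))

  isGalois⇒Γ⊆ : {s : Sort} {F : Pred (Z s) 0ℓ} → IsGalois s F →
                {u : Z s} → u ∈ F → Γ u ⊆ F
  isGalois⇒Γ⊆ {one} (_ , cl⊆F) u∈F u⪯w = cl⊆F (λ y yF → u⪯w y (yF _ u∈F))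
  isGalois⇒Γ⊆ {∂}   (_ , cl⊆F) u∈F u⪯w = cl⊆F (λ x xF → u⪯w x (xF _ u∈F))

  α-mono : {n : ℕ} {i : Fin n → Sort} {t : Sort} (R : Z t → Args i → Set)
           {V W : Sets i} → ((j : Fin n) → V j ⊆ W j) → α R V ⊆ α R W
  α-mono R V⊆W (w , w∈V , Rzw) = w , (λ j → V⊆W j (w∈V j)) , Rzw

  upd-mono : {n : ℕ} {i : Fin n → Sort} (E : Sets i) (k : Fin n)
             {A B : Pred (Z (i k)) 0ℓ} → A ⊆ B →
             (j : Fin n) → upd E k A j ⊆ upd E k B j
  upd-mono E k A⊆B j with j ≟ k
  ... | yes refl = A⊆B
  ... | no _     = id

  β≐Γ-residual : {n : ℕ} {i : Fin n → Sort} {t : Sort}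
                 (R : Z t → Args i → Set) (E : Sets i) (k : Fin n)
                 (G : Pred (Z t) 0ℓ) →
                 β R E k G ≐ (λ u → α R (upd E k (Γ u)) ⊆ G)
  β≐Γ-residual R E k G = to , from
    where
    to : β R E k G ⊆ (λ u → α R (upd E k (Γ u)) ⊆ G)
    to (F , F-galois , αF⊆G , u∈F) =
      αF⊆G ∘ α-mono R (upd-mono E k (isGalois⇒Γ⊆ F-galois u∈F))
    from : (λ u → α R (upd E k (Γ u)) ⊆ G) ⊆ β R E k G
    from {u} αΓu⊆G = Γ u , Γ-isGalois u , αΓu⊆G , ⪯-refl u

lemma2p14 : (X Y : Set) (I : X → Y → Set) →
    let open Polarity X Y I in
    {n : ℕ} (i : Fin n → Sort) (t : Sort)
    (R : Z t → Args i → Set) (E : Sets i) (G : Pred (Z t) 0ℓ) (k : Fin n) →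
    ((j : Fin n) → IsGalois (i j) (E j)) → IsGalois t G →
    (β R E k G ≐ (λ w → Σ (Z (i k)) λ u →
        IsGalois (i k) (Γ u) × (α R (upd E k (Γ u)) ⊆ G) × (w ∈ Γ u)))
    × (β R E k G ≐ (λ u → α R (upd E k (Γ u)) ⊆ G))
lemma2p14 X Y I i t R E G k _ _ = (to , from) , β≐Γ-residual R E k G
  where
  open Polarity X Y I
  open PolarityProperties X Y I
  to : β R E k G ⊆ (λ w → Σ (Z (i k)) λ u →
         IsGalois (i k) (Γ u) × (α R (upd E k (Γ u)) ⊆ G) × (w ∈ Γ u))
  to {w} w∈β = w , Γ-isGalois w , proj₁ (β≐Γ-residual R E k G) w∈β , ⪯-refl w
  from : (λ w → Σ (Z (i k)) λ u →
           IsGalois (i k) (Γ u) × (α R (upd E k (Γ u)) ⊆ G) × (w ∈ Γ u))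
         ⊆ β R E k G
  from (u , Γu-galois , αΓu⊆G , w∈Γu) = Γ u , Γu-galois , αΓu⊆G , w∈Γu
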